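{- Let $p, q, t$ be three distinct primes and $r_1, r_2, r_3$ arbitrary integers. For $1 \le n \le pqt$ let $\gamma(n)$ be the number of the congruences $n \equiv r_1 \pmod p$, $n \equiv r_2 \pmod q$, $n \equiv r_3 \pmod t$ that $n$ satisfies. Then $$\#\{1 \le n \le pqt : \gamma(n) \le 1\} = A_3(p,q,t) = \det\begin{bmatrix} p & 1 & 1 \\ 1 & q & 1 \\ 1 & 1 & t\end{bmatrix}.$$ -}

module Defs where

open import Data.Nat as ℕ using (ℕ; suc; _≤_; _≤?_)
open import Data.Integer as ℤ using (ℤ; +_; _-_; _*_; _+_)
open import Data.Integer.Divisibility.Signed using (_∣_; _∣?_)
open import Data.List using (List; filter; length; map; upTo)
open import Relation.Nullary.Decidable using (Dec; yes; no)

_≡_[mod_] : ℤ → ℤ → ℤ → Set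
a ≡ b [mod m ] = m ∣ (a - b)

[_≡_mod_] : ℤ → ℤ → ℤ → ℕ
[ a ≡ b mod m ] with m ∣? (a - b)
... | yes _ = 1
... | no  _ = 0

γ : (p q t : ℕ) (r₁ r₂ r₃ : ℤ) → ℕ → ℕ
γ p q t r₁ r₂ r₃ n =
  [ + n ≡ r₁ mod + p ] ℕ.+ [ + n ≡ r₂ mod + q ] ℕ.+ [ + n ≡ r₃ mod + t ]

oneTo : ℕ → List ℕ
oneTo N = map suc (upTo N)

countγ≤1 : (p q t : ℕ) (r₁ r₂ r₃ : ℤ) → ℕ
countγ≤1 p q t r₁ r₂ r₃ =
  length (filter (λ n → γ p q t r₁ r₂ r₃ n ≤? 1) (oneTo (p ℕ.* q ℕ.* t)))

det3 : ℤ → ℤ → ℤ → ℤ → ℤ → ℤ → ℤ → ℤ → ℤ → ℤ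
det3 a b c d e f g h i =
  a * (e * i - f * h) - b * (d * i - f * g) + c * (d * h - e * g)

A₃ : ℕ → ℕ → ℕ → ℤ
A₃ p q t = det3 (+ p) (+ 1) (+ 1)
                (+ 1) (+ q) (+ 1)
                (+ 1) (+ 1) (+ t)

-- For 0/1 values a, b, c one has  [a + b + c ≤ 1] + (bc + ac + ab) = 1 + 2abc.  Take for a, b, c
-- the indicators of the three congruences and sum over 1 ≤ n ≤ pqt.  By the Chinese remainder
-- theorem the product of two of them is the indicator of a single residue class modulo the product
-- of the two moduli, and abc that of a single class modulo pqt; a residue class modulo M meets
-- every M consecutive integers exactly once.  Hence  #{γ ≤ 1} + (p + q + t) = pqt + 2, and
-- pqt − p − q − t + 2 is the determinant.

module Submission where

open import Defs
open import Data.Nat using (ℕ)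
open import Data.Nat.Primality using (Prime)
open import Data.Integer using (ℤ; +_)
open import Relation.Binary.PropositionalEquality using (_≡_; _≢_)

open import Data.Nat using (zero; suc; _+_; _*_; _∸_; _≤_; _<_; _≤?_; _≟_; NonZero; z≤n; s≤s)
open import Data.Nat.Properties
  using (+-identityʳ; +-suc; +-assoc; *-identityˡ; *-comm; *-assoc; m*n≢0;
         ≤-refl; ≤-antisym; ≤-total; ≤-pred; m≤n⇒m≤1+n; ≤∧≢⇒<;
         <-cmp; <-irrefl; <-trans; <-≤-trans; n<1+n; m∸n≡0⇒m≤n; ∸-monoʳ-<)
open import Data.Nat.Divisibility using (_∣_; >⇒∤; m∣m*n; n∣m*n; ∣-trans)
open import Data.Nat.Coprimality as Coprimality
  using (Coprime; coprime⇒gcd≡1; coprime-divisor; coprime-Bézout; prime⇒coprime)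
open import Data.Nat.GCD using (gcd; module Bézout)
open import Data.Nat.LCM using (lcm; lcm-least; gcd*lcm)
open import Data.Nat.Primality using (prime⇒nonZero)
import Data.Nat.Tactic.RingSolver as ℕ-Solver
import Data.Integer as ℤ
import Data.Integer.Properties as ℤ
import Data.Integer.DivMod as ℤ
import Data.Integer.Divisibility.Signed as ℤ∣
import Data.Integer.Tactic.RingSolver as ℤ-Solver
open import Data.List using ([]; _∷_; [_]; _++_; filter; length; map; upTo)
open import Data.List.Properties using (upTo-∷ʳ; map-++; filter-++; length-++)
open import Data.Product using (∃-syntax; _×_; _,_; map₂; swap)
open import Data.Sum using (inj₁; inj₂)
open import Function using (_∘_)
open import Level using (0ℓ)
open import Relation.Binary.Definitions using (tri<; tri≈; tri>)
open import Relation.Nullary using (Dec; yes; no; contradiction; _×-dec_)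
open import Relation.Unary using (Pred; Decidable)
open import Relation.Binary.PropositionalEquality
  using (refl; sym; trans; cong; cong₂; subst; module ≡-Reasoning)
open ≡-Reasoning

χ : ∀ {a} {P : Set a} → Dec P → ℕ
χ (yes _) = 1
χ (no _)  = 0

χ-≤1 : ∀ {a} {P : Set a} (P? : Dec P) → χ P? ≤ 1
χ-≤1 (yes _) = s≤s z≤n
χ-≤1 (no _)  = z≤n

χ-cong : ∀ {a b} {P : Set a} {Q : Set b} → (P → Q) → (Q → P) →
         (P? : Dec P) (Q? : Dec Q) → χ P? ≡ χ Q?
χ-cong P⇒Q Q⇒P (yes p) (yes q) = refl
χ-cong P⇒Q Q⇒P (yes p) (no ¬q) = contradiction (P⇒Q p) ¬q
χ-cong P⇒Q Q⇒P (no ¬p) (yes q) = contradiction (Q⇒P q) ¬p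
χ-cong P⇒Q Q⇒P (no ¬p) (no ¬q) = refl

χ-× : ∀ {a b} {P : Set a} {Q : Set b} (P? : Dec P) (Q? : Dec Q) →
      χ P? * χ Q? ≡ χ (P? ×-dec Q?)
χ-× (yes _) (yes _) = refl
χ-× (yes _) (no _)  = refl
χ-× (no _)  _       = refl

[≡mod]≡χ : ∀ a b m → [ a ≡ b mod m ] ≡ χ (m ℤ∣.∣? (a ℤ.- b))
[≡mod]≡χ a b m with m ℤ∣.∣? (a ℤ.- b)
... | yes _ = refl
... | no _  = refl

[≡mod]-≤1 : ∀ a b m → [ a ≡ b mod m ] ≤ 1
[≡mod]-≤1 a b m = subst (_≤ 1) (sym ([≡mod]≡χ a b m)) (χ-≤1 _)

[≡mod]-cong : ∀ {a b m a′ b′ m′} →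
              (a ≡ b [mod m ] → a′ ≡ b′ [mod m′ ]) → (a′ ≡ b′ [mod m′ ] → a ≡ b [mod m ]) →
              [ a ≡ b mod m ] ≡ [ a′ ≡ b′ mod m′ ]
[≡mod]-cong {a} {b} {m} {a′} {b′} {m′} to from = begin
  [ a ≡ b mod m ]                 ≡⟨ [≡mod]≡χ a b m ⟩
  χ (m ℤ∣.∣? (a ℤ.- b))           ≡⟨ χ-cong to from _ _ ⟩
  χ (m′ ℤ∣.∣? (a′ ℤ.- b′))        ≡⟨ sym ([≡mod]≡χ a′ b′ m′) ⟩
  [ a′ ≡ b′ mod m′ ]              ∎

module _ {m : ℤ} where

  ≡-mod-sym : ∀ a b → a ≡ b [mod m ] → b ≡ a [mod m ]
  ≡-mod-sym a b a≡b = subst (m ℤ∣.∣_) negate (ℤ∣.∣m⇒∣-m a≡b)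
    where
    negate : ℤ.- (a ℤ.- b) ≡ b ℤ.- a
    negate = ℤ-Solver.solve (a ∷ b ∷ [])

  ≡-mod-trans : ∀ a b c → a ≡ b [mod m ] → b ≡ c [mod m ] → a ≡ c [mod m ]
  ≡-mod-trans a b c a≡b b≡c = subst (m ℤ∣.∣_) telescope (ℤ∣.∣m∣n⇒∣m+n a≡b b≡c)
    where
    telescope : (a ℤ.- b) ℤ.+ (b ℤ.- c) ≡ a ℤ.- c
    telescope = ℤ-Solver.solve (a ∷ b ∷ c ∷ [])

  ≡-mod-period : ∀ a → (m ℤ.+ a) ≡ a [mod m ]
  ≡-mod-period a = subst (m ℤ∣.∣_) (sym cancel) ℤ∣.∣-refl
    where
    cancel : (m ℤ.+ a) ℤ.- a ≡ m
    cancel = ℤ-Solver.solve (a ∷ m ∷ [])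

  ≡-mod-%-residue : ∀ a .{{_ : ℤ.NonZero m}} → (+ (a ℤ.% m)) ≡ a [mod m ]
  ≡-mod-%-residue a = ℤ∣.divides (ℤ.- (a ℤ./ m)) (begin
    + r ℤ.- a                          ≡⟨ cong (λ z → + r ℤ.- z) (ℤ.a≡a%n+[a/n]*n a m) ⟩
    + r ℤ.- (+ r ℤ.+ (a ℤ./ m) ℤ.* m)  ≡⟨ cancel (+ r) (a ℤ./ m) ⟩
    ℤ.- (a ℤ./ m) ℤ.* m                ∎)
    where
    r : ℕ
    r = a ℤ.% m
    cancel : ∀ x y → x ℤ.- (x ℤ.+ y ℤ.* m) ≡ ℤ.- y ℤ.* m
    cancel x y = ℤ-Solver.solve (x ∷ y ∷ m ∷ [])

≡-mod-∣ : ∀ {d m} a b → d ∣ m → a ≡ b [mod + m ] → a ≡ b [mod + d ]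
≡-mod-∣ a b d∣m = ℤ∣.∣-trans (ℤ∣.∣ᵤ⇒∣ d∣m)

coprime-∣⇒*∣ : ∀ {m n o} → Coprime m n → m ∣ o → n ∣ o → m * n ∣ o
coprime-∣⇒*∣ {m} {n} m⊥n m∣o n∣o = subst (_∣ _) lcm≡m*n (lcm-least m∣o n∣o)
  where
  lcm≡m*n : lcm m n ≡ m * n
  lcm≡m*n = begin
    lcm m n           ≡⟨ sym (*-identityˡ (lcm m n)) ⟩
    1 * lcm m n       ≡⟨ cong (_* lcm m n) (sym (coprime⇒gcd≡1 m⊥n)) ⟩
    gcd m n * lcm m n ≡⟨ gcd*lcm m n ⟩
    m * n             ∎

≢⇒coprime : ∀ {p q} → Prime p → Prime q → p ≢ q → Coprime p q
≢⇒coprime {p} {q} p-prime q-prime p≢q with <-cmp p q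
... | tri< p<q _ _ = Coprimality.sym (prime⇒coprime q-prime {{prime⇒nonZero p-prime}} p<q)
... | tri≈ _ p≡q _ = contradiction p≡q p≢q
... | tri> _ _ q<p = prime⇒coprime p-prime {{prime⇒nonZero q-prime}} q<p

coprime-* : ∀ {m n o} → Coprime m n → Coprime m o → Coprime m (n * o)
coprime-* {n = n} m⊥n m⊥o {d} (d∣m , d∣n*o) = m⊥o (d∣m , coprime-divisor d⊥n d∣n*o)
  where
  d⊥n : Coprime d n
  d⊥n (e∣d , e∣n) = m⊥n (∣-trans e∣d d∣m , e∣n)

≡-mod-* : ∀ {m k} a b → Coprime m k →
          a ≡ b [mod + m ] → a ≡ b [mod + k ] → a ≡ b [mod + (m * k) ]
≡-mod-* a b m⊥k a≡b[m] a≡b[k] = ℤ∣.∣ᵤ⇒∣ (coprime-∣⇒*∣ m⊥k (ℤ∣.∣⇒∣ᵤ a≡b[m]) (ℤ∣.∣⇒∣ᵤ a≡b[k]))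

crt-basis : ∀ {m k} u v → 1 + u * m ≡ v * k →
            (+ (v * k)) ≡ + 1 [mod + m ] × (+ (v * k)) ≡ + 0 [mod + k ]
crt-basis {m} {k} u v 1+um≡vk =
    ℤ∣.divides (+ u) (begin
      + (v * k) ℤ.- + 1            ≡⟨ cong (λ z → + z ℤ.- + 1) (sym 1+um≡vk) ⟩
      (+ 1 ℤ.+ + (u * m)) ℤ.- + 1  ≡⟨ cancel (+ (u * m)) ⟩
      + (u * m)                    ≡⟨ ℤ.pos-* u m ⟩
      + u ℤ.* + m                  ∎)
  , ℤ∣.divides (+ v) (trans (ℤ.+-identityʳ (+ (v * k))) (ℤ.pos-* v k))
  where
  cancel : ∀ x → (+ 1 ℤ.+ x) ℤ.- + 1 ≡ x
  cancel = ℤ-Solver.solve-∀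

crt-from-basis : ∀ {m k} e → e ≡ + 1 [mod m ] × e ≡ + 0 [mod k ] →
                 ∀ a b → ∃[ x ] (x ≡ a [mod m ] × x ≡ b [mod k ])
crt-from-basis {m} {k} e (e≡1 , e≡0) a b =
  a ℤ.* e ℤ.+ b ℤ.* (+ 1 ℤ.- e) ,
  subst (m ℤ∣.∣_) (sym (towards-a a b e)) (ℤ∣.∣n⇒∣m*n (a ℤ.- b) e≡1) ,
  subst (k ℤ∣.∣_) (sym (towards-b a b e)) (ℤ∣.∣n⇒∣m*n (a ℤ.- b) e≡0)
  where
  towards-a : ∀ a b e → a ℤ.* e ℤ.+ b ℤ.* (+ 1 ℤ.- e) ℤ.- a ≡ (a ℤ.- b) ℤ.* (e ℤ.- + 1)
  towards-a = ℤ-Solver.solve-∀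
  towards-b : ∀ a b e → a ℤ.* e ℤ.+ b ℤ.* (+ 1 ℤ.- e) ℤ.- b ≡ (a ℤ.- b) ℤ.* (e ℤ.- + 0)
  towards-b = ℤ-Solver.solve-∀

-- The ℕ-valued Bézout identity has two sign patterns; in the second one it yields the basis
-- element for k rather than m, so the two moduli swap roles.
crt : ∀ {m k} → Coprime m k → ∀ a b → ∃[ x ] (x ≡ a [mod + m ] × x ≡ b [mod + k ])
crt {m} {k} m⊥k a b with coprime-Bézout m⊥k
... | Bézout.-+ u v 1+um≡vk = crt-from-basis (+ (v * k)) (crt-basis u v 1+um≡vk) a b
... | Bézout.+- u v 1+vk≡um = map₂ swap (crt-from-basis (+ (u * m)) (crt-basis v u 1+vk≡um) b a)

∃-representative : ∀ M .{{_ : NonZero M}} c → ∃[ r ] (1 ≤ r × r ≤ M × (+ r) ≡ c [mod + M ])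
∃-representative M c =
  suc k , s≤s z≤n , ℤ.n%d<d (c ℤ.- + 1) (+ M) ,
  subst (+ M ℤ∣.∣_) (sym (shift (+ k) c)) (≡-mod-%-residue (c ℤ.- + 1))
  where
  k : ℕ
  k = (c ℤ.- + 1) ℤ.% + M
  shift : ∀ x c → (+ 1 ℤ.+ x) ℤ.- c ≡ x ℤ.- (c ℤ.- + 1)
  shift = ℤ-Solver.solve-∀

∣∧<⇒≡0 : ∀ {m n} → m ∣ n → n < m → n ≡ 0
∣∧<⇒≡0 {n = zero}  _   _   = refl
∣∧<⇒≡0 {n = suc _} m∣n n<m = contradiction m∣n (>⇒∤ n<m)

≡-mod⇒≡-≤ : ∀ {M n r} → 1 ≤ n → n ≤ r → r ≤ M → (+ r) ≡ (+ n) [mod + M ] → n ≡ r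
≡-mod⇒≡-≤ {M} {n} {r} 1≤n n≤r r≤M r≡n = ≤-antisym n≤r (m∸n≡0⇒m≤n (∣∧<⇒≡0 M∣r∸n r∸n<M))
  where
  r-n≡r∸n : + r ℤ.- + n ≡ + (r ∸ n)
  r-n≡r∸n = trans (ℤ.m-n≡m⊖n r n) (ℤ.⊖-≥ n≤r)
  M∣r∸n : M ∣ r ∸ n
  M∣r∸n = subst (M ∣_) (cong ℤ.∣_∣ r-n≡r∸n) (ℤ∣.∣⇒∣ᵤ r≡n)
  r∸n<M : r ∸ n < M
  r∸n<M = <-≤-trans (∸-monoʳ-< 1≤n n≤r) r≤M

≡-mod⇒≡ : ∀ {M n r} → 1 ≤ n → n ≤ M → 1 ≤ r → r ≤ M → (+ n) ≡ (+ r) [mod + M ] → n ≡ r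
≡-mod⇒≡ {n = n} {r = r} 1≤n n≤M 1≤r r≤M n≡r with ≤-total n r
... | inj₁ n≤r = ≡-mod⇒≡-≤ 1≤n n≤r r≤M (≡-mod-sym (+ n) (+ r) n≡r)
... | inj₂ r≤n = sym (≡-mod⇒≡-≤ 1≤r r≤n n≤M n≡r)

sumTo : (ℕ → ℕ) → ℕ → ℕ
sumTo f zero    = 0
sumTo f (suc N) = sumTo f N + f (suc N)

sumTo-cong : ∀ {f g} N → (∀ n → 1 ≤ n → n ≤ N → f n ≡ g n) → sumTo f N ≡ sumTo g N
sumTo-cong zero    f≡g = refl
sumTo-cong (suc N) f≡g = cong₂ _+_ (sumTo-cong N (λ n 1≤n n≤N → f≡g n 1≤n (m≤n⇒m≤1+n n≤N)))
                                   (f≡g (suc N) (s≤s z≤n) ≤-refl)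

sumTo-+ : ∀ f m n → sumTo f (m + n) ≡ sumTo f m + sumTo (λ j → f (m + j)) n
sumTo-+ f m zero    = trans (cong (sumTo f) (+-identityʳ m)) (sym (+-identityʳ (sumTo f m)))
sumTo-+ f m (suc n) = begin
  sumTo f (m + suc n)                                    ≡⟨ cong (sumTo f) (+-suc m n) ⟩
  sumTo f (m + n) + f (suc (m + n))                      ≡⟨ cong₂ _+_ (sumTo-+ f m n)
                                                                      (cong f (sym (+-suc m n))) ⟩
  sumTo f m + sumTo (λ j → f (m + j)) n + f (m + suc n)  ≡⟨ +-assoc (sumTo f m) _ _ ⟩
  sumTo f m + sumTo (λ j → f (m + j)) (suc n)            ∎

sumTo-χ≟-< : ∀ {r} N → N < r → sumTo (λ n → χ (n ≟ r)) N ≡ 0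
sumTo-χ≟-< zero N<r = refl
sumTo-χ≟-< {r} (suc N) N<r with suc N ≟ r
... | yes refl = contradiction N<r (<-irrefl refl)
... | no _     = trans (+-identityʳ _) (sumTo-χ≟-< N (<-trans (n<1+n N) N<r))

sumTo-χ≟ : ∀ {r} N → 1 ≤ r → r ≤ N → sumTo (λ n → χ (n ≟ r)) N ≡ 1
sumTo-χ≟ zero (s≤s z≤n) ()
sumTo-χ≟ {r} (suc N) 1≤r r≤N with suc N ≟ r
... | yes refl = cong (_+ 1) (sumTo-χ≟-< N (n<1+n N))
... | no N≢r   = trans (+-identityʳ _) (sumTo-χ≟ N 1≤r (≤-pred (≤∧≢⇒< r≤N (N≢r ∘ sym))))

length-filter-oneTo : ∀ {P : Pred ℕ 0ℓ} (P? : Decidable P) N →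
                      length (filter P? (oneTo N)) ≡ sumTo (λ n → χ (P? n)) N
length-filter-oneTo P? zero    = refl
length-filter-oneTo P? (suc N) = begin
  length (filter P? (map suc (upTo (suc N))))
    ≡⟨ cong (length ∘ filter P? ∘ map suc) (sym (upTo-∷ʳ N)) ⟩
  length (filter P? (map suc (upTo N ++ [ N ])))
    ≡⟨ cong (length ∘ filter P?) (map-++ suc (upTo N) [ N ]) ⟩
  length (filter P? (oneTo N ++ [ suc N ]))
    ≡⟨ cong length (filter-++ P? (oneTo N) [ suc N ]) ⟩
  length (filter P? (oneTo N) ++ filter P? [ suc N ])
    ≡⟨ length-++ (filter P? (oneTo N)) ⟩
  length (filter P? (oneTo N)) + length (filter P? [ suc N ])
    ≡⟨ cong₂ _+_ (length-filter-oneTo P? N) length-filter-singleton ⟩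
  sumTo (λ n → χ (P? n)) (suc N) ∎
  where
  length-filter-singleton : length (filter P? [ suc N ]) ≡ χ (P? (suc N))
  length-filter-singleton with P? (suc N)
  ... | yes _ = refl
  ... | no _  = refl

[≡mod]-periodic : ∀ M c j → [ + (M + j) ≡ c mod + M ] ≡ [ + j ≡ c mod + M ]
[≡mod]-periodic M c j =
  [≡mod]-cong (≡-mod-trans (+ j) (+ (M + j)) c (≡-mod-sym (+ (M + j)) (+ j) (≡-mod-period (+ j))))
              (≡-mod-trans (+ (M + j)) (+ j) c (≡-mod-period (+ j)))

sumTo-[≡mod]-period : ∀ M .{{_ : NonZero M}} c → sumTo (λ n → [ + n ≡ c mod + M ]) M ≡ 1
sumTo-[≡mod]-period M c with ∃-representative M c
... | r , 1≤r , r≤M , r≡c = trans (sumTo-cong M indicator≡χ≟) (sumTo-χ≟ M 1≤r r≤M)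
  where
  indicator≡χ≟ : ∀ n → 1 ≤ n → n ≤ M → [ + n ≡ c mod + M ] ≡ χ (n ≟ r)
  indicator≡χ≟ n 1≤n n≤M = trans ([≡mod]≡χ (+ n) c (+ M)) (χ-cong
    (λ n≡c → ≡-mod⇒≡ 1≤n n≤M 1≤r r≤M (≡-mod-trans (+ n) c (+ r) n≡c (≡-mod-sym (+ r) c r≡c)))
    (λ { refl → r≡c }) _ _)

sumTo-[≡mod] : ∀ M .{{_ : NonZero M}} c s → sumTo (λ n → [ + n ≡ c mod + M ]) (s * M) ≡ s
sumTo-[≡mod] M c zero    = refl
sumTo-[≡mod] M c (suc s) = begin
  sumTo f (M + s * M)
    ≡⟨ sumTo-+ f M (s * M) ⟩
  sumTo f M + sumTo (λ j → f (M + j)) (s * M)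
    ≡⟨ cong₂ _+_ (sumTo-[≡mod]-period M c) (sumTo-cong (s * M) (λ j _ _ → [≡mod]-periodic M c j)) ⟩
  1 + sumTo f (s * M)
    ≡⟨ cong suc (sumTo-[≡mod] M c s) ⟩
  suc s ∎
  where
  f : ℕ → ℕ
  f n = [ + n ≡ c mod + M ]

[≡mod]*[≡mod] : ∀ {m k x a b} → Coprime m k → x ≡ a [mod + m ] → x ≡ b [mod + k ] → ∀ n →
                [ n ≡ a mod + m ] * [ n ≡ b mod + k ] ≡ [ n ≡ x mod + (m * k) ]
[≡mod]*[≡mod] {m} {k} {x} {a} {b} m⊥k x≡a x≡b n = begin
  [ n ≡ a mod + m ] * [ n ≡ b mod + k ]
    ≡⟨ cong₂ _*_ ([≡mod]≡χ n a (+ m)) ([≡mod]≡χ n b (+ k)) ⟩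
  χ (+ m ℤ∣.∣? (n ℤ.- a)) * χ (+ k ℤ∣.∣? (n ℤ.- b))
    ≡⟨ χ-× (+ m ℤ∣.∣? (n ℤ.- a)) (+ k ℤ∣.∣? (n ℤ.- b)) ⟩
  χ (+ m ℤ∣.∣? (n ℤ.- a) ×-dec + k ℤ∣.∣? (n ℤ.- b))
    ≡⟨ χ-cong to from _ _ ⟩
  χ (+ (m * k) ℤ∣.∣? (n ℤ.- x))
    ≡⟨ sym ([≡mod]≡χ n x (+ (m * k))) ⟩
  [ n ≡ x mod + (m * k) ] ∎
  where
  to : n ≡ a [mod + m ] × n ≡ b [mod + k ] → n ≡ x [mod + (m * k) ]
  to (n≡a , n≡b) = ≡-mod-* n x m⊥k (≡-mod-trans n a x n≡a (≡-mod-sym x a x≡a))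
                                   (≡-mod-trans n b x n≡b (≡-mod-sym x b x≡b))
  from : n ≡ x [mod + (m * k) ] → n ≡ a [mod + m ] × n ≡ b [mod + k ]
  from n≡x = ≡-mod-trans n x a (≡-mod-∣ n x (m∣m*n k) n≡x) x≡a
           , ≡-mod-trans n x b (≡-mod-∣ n x (n∣m*n m) n≡x) x≡b

sumTo-[≡mod]*[≡mod] : ∀ {m k} .{{_ : NonZero m}} .{{_ : NonZero k}} → Coprime m k → ∀ a b s →
                      sumTo (λ n → [ + n ≡ a mod + m ] * [ + n ≡ b mod + k ]) (s * (m * k)) ≡ s
sumTo-[≡mod]*[≡mod] {m} {k} m⊥k a b s with crt m⊥k a b
... | x , x≡a , x≡b =
  trans (sumTo-cong (s * (m * k)) (λ n _ _ → [≡mod]*[≡mod] m⊥k x≡a x≡b (+ n)))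
        (sumTo-[≡mod] (m * k) {{m*n≢0 m k}} x s)

sumTo-[≡mod]*[≡mod]*[≡mod] :
  ∀ {m k o} .{{_ : NonZero m}} .{{_ : NonZero k}} .{{_ : NonZero o}} →
  Coprime m k → Coprime m o → Coprime k o → ∀ a b c s →
  sumTo (λ n → [ + n ≡ a mod + m ] * [ + n ≡ b mod + k ] * [ + n ≡ c mod + o ]) (s * (m * k * o)) ≡ s
sumTo-[≡mod]*[≡mod]*[≡mod] {m} {k} {o} m⊥k m⊥o k⊥o a b c s with crt m⊥k a b
... | x , x≡a , x≡b =
  trans (sumTo-cong (s * (m * k * o)) (λ n _ _ → cong (_* [ + n ≡ c mod + o ])
                                                      ([≡mod]*[≡mod] m⊥k x≡a x≡b (+ n))))
        (sumTo-[≡mod]*[≡mod] {{m*n≢0 m k}} mk⊥o x c s)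
  where
  mk⊥o : Coprime (m * k) o
  mk⊥o = Coprimality.sym (coprime-* (Coprimality.sym m⊥o) (Coprimality.sym k⊥o))

χ[≤1]-identity : ∀ {x y z} → x ≤ 1 → y ≤ 1 → z ≤ 1 →
                 χ (x + y + z ≤? 1) + (y * z + x * z + x * y) ≡ 1 + 2 * (x * y * z)
χ[≤1]-identity z≤n       z≤n       z≤n       = refl
χ[≤1]-identity z≤n       z≤n       (s≤s z≤n) = refl
χ[≤1]-identity z≤n       (s≤s z≤n) z≤n       = refl
χ[≤1]-identity z≤n       (s≤s z≤n) (s≤s z≤n) = refl
χ[≤1]-identity (s≤s z≤n) z≤n       z≤n       = refl
χ[≤1]-identity (s≤s z≤n) z≤n       (s≤s z≤n) = refl
χ[≤1]-identity (s≤s z≤n) (s≤s z≤n) z≤n       = refl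
χ[≤1]-identity (s≤s z≤n) (s≤s z≤n) (s≤s z≤n) = refl

sumTo-χ[≤1] : ∀ (a b c : ℕ → ℕ) → (∀ n → a n ≤ 1) → (∀ n → b n ≤ 1) → (∀ n → c n ≤ 1) → ∀ N →
              sumTo (λ n → χ (a n + b n + c n ≤? 1)) N
                + (sumTo (λ n → b n * c n) N + sumTo (λ n → a n * c n) N + sumTo (λ n → a n * b n) N)
              ≡ N + 2 * sumTo (λ n → a n * b n * c n) N
sumTo-χ[≤1] a b c a≤1 b≤1 c≤1 zero    = refl
sumTo-χ[≤1] a b c a≤1 b≤1 c≤1 (suc N) = begin
  (S₀ + h) + ((S₁ + bc) + (S₂ + ac) + (S₃ + ab))  ≡⟨ regroup S₀ S₁ S₂ S₃ h bc ac ab ⟩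
  (S₀ + (S₁ + S₂ + S₃)) + (h + (bc + ac + ab))      ≡⟨ cong₂ _+_ (sumTo-χ[≤1] a b c a≤1 b≤1 c≤1 N)
                                                       (χ[≤1]-identity (a≤1 n) (b≤1 n) (c≤1 n)) ⟩
  (N + 2 * S) + (1 + 2 * abc)                       ≡⟨ collect N S abc ⟩
  suc N + 2 * (S + abc)                             ∎
  where
  n : ℕ
  n = suc N
  S₀ S₁ S₂ S₃ S h ab ac bc abc : ℕ
  S₀  = sumTo (λ n → χ (a n + b n + c n ≤? 1)) N
  S₁  = sumTo (λ n → b n * c n) N
  S₂  = sumTo (λ n → a n * c n) N
  S₃  = sumTo (λ n → a n * b n) N
  S   = sumTo (λ n → a n * b n * c n) N
  h   = χ (a n + b n + c n ≤? 1)
  ab  = a n * b n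
  ac  = a n * c n
  bc  = b n * c n
  abc = a n * b n * c n
  regroup : ∀ w x y z w′ x′ y′ z′ →
            (w + w′) + ((x + x′) + (y + y′) + (z + z′)) ≡ (w + (x + y + z)) + (w′ + (x′ + y′ + z′))
  regroup = ℕ-Solver.solve-∀
  collect : ∀ n s d → (n + 2 * s) + (1 + 2 * d) ≡ suc n + 2 * (s + d)
  collect = ℕ-Solver.solve-∀

countγ≤1-pairwise-coprime : ∀ p q t .{{_ : NonZero p}} .{{_ : NonZero q}} .{{_ : NonZero t}} →
                            Coprime p q → Coprime p t → Coprime q t → ∀ r₁ r₂ r₃ →
                            countγ≤1 p q t r₁ r₂ r₃ + (p + q + t) ≡ p * q * t + 2
countγ≤1-pairwise-coprime p q t p⊥q p⊥t q⊥t r₁ r₂ r₃ = begin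
  countγ≤1 p q t r₁ r₂ r₃ + (p + q + t)
    ≡⟨ cong₂ _+_ (length-filter-oneTo (λ n → γ p q t r₁ r₂ r₃ n ≤? 1) N)
                 (sym (cong₂ _+_ (cong₂ _+_ Σbc Σac) Σab)) ⟩
  sumTo (λ n → χ (a n + b n + c n ≤? 1)) N
    + (sumTo (λ n → b n * c n) N + sumTo (λ n → a n * c n) N + sumTo (λ n → a n * b n) N)
    ≡⟨ sumTo-χ[≤1] a b c (λ _ → [≡mod]-≤1 _ _ _) (λ _ → [≡mod]-≤1 _ _ _) (λ _ → [≡mod]-≤1 _ _ _) N ⟩
  N + 2 * sumTo (λ n → a n * b n * c n) N
    ≡⟨ cong (λ s → N + 2 * s) Σabc ⟩
  N + 2 ∎
  where
  N : ℕ
  N = p * q * t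
  a b c : ℕ → ℕ
  a n = [ + n ≡ r₁ mod + p ]
  b n = [ + n ≡ r₂ mod + q ]
  c n = [ + n ≡ r₃ mod + t ]
  Σab : sumTo (λ n → a n * b n) N ≡ t
  Σab = trans (cong (sumTo _) (*-comm (p * q) t)) (sumTo-[≡mod]*[≡mod] p⊥q r₁ r₂ t)
  Σac : sumTo (λ n → a n * c n) N ≡ q
  Σac = trans (cong (sumTo _) (reorder p q t)) (sumTo-[≡mod]*[≡mod] p⊥t r₁ r₃ q)
    where
    reorder : ∀ p q t → p * q * t ≡ q * (p * t)
    reorder = ℕ-Solver.solve-∀
  Σbc : sumTo (λ n → b n * c n) N ≡ p
  Σbc = trans (cong (sumTo _) (*-assoc p q t)) (sumTo-[≡mod]*[≡mod] q⊥t r₂ r₃ p)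
  Σabc : sumTo (λ n → a n * b n * c n) N ≡ 1
  Σabc = trans (cong (sumTo _) (sym (*-identityˡ N)))
               (sumTo-[≡mod]*[≡mod]*[≡mod] p⊥q p⊥t q⊥t r₁ r₂ r₃ 1)

A₃-closed-form : ∀ p q t → A₃ p q t ≡ + p ℤ.* + q ℤ.* + t ℤ.+ + 2 ℤ.- (+ p ℤ.+ + q ℤ.+ + t)
A₃-closed-form p q t = expand (+ p) (+ q) (+ t)
  where
  expand : ∀ p q t →
           p ℤ.* (q ℤ.* t ℤ.- + 1 ℤ.* + 1) ℤ.- + 1 ℤ.* (+ 1 ℤ.* t ℤ.- + 1 ℤ.* + 1)
             ℤ.+ + 1 ℤ.* (+ 1 ℤ.* + 1 ℤ.- q ℤ.* + 1)
           ≡ p ℤ.* q ℤ.* t ℤ.+ + 2 ℤ.- (p ℤ.+ q ℤ.+ t)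
  expand = ℤ-Solver.solve-∀

+≡A₃ : ∀ {C} p q t → C + (p + q + t) ≡ p * q * t + 2 → + C ≡ A₃ p q t
+≡A₃ {C} p q t C+s≡pqt+2 = begin
  + C
    ≡⟨ cancel (+ C) (+ (p + q + t)) ⟩
  + (C + (p + q + t)) ℤ.- + (p + q + t)
    ≡⟨ cong (λ z → + z ℤ.- + (p + q + t)) C+s≡pqt+2 ⟩
  + (p * q * t) ℤ.+ + 2 ℤ.- + (p + q + t)
    ≡⟨ cong (λ z → z ℤ.+ + 2 ℤ.- + (p + q + t)) pos-*³ ⟩
  + p ℤ.* + q ℤ.* + t ℤ.+ + 2 ℤ.- (+ p ℤ.+ + q ℤ.+ + t)
    ≡⟨ sym (A₃-closed-form p q t) ⟩
  A₃ p q t ∎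
  where
  cancel : ∀ c s → c ≡ c ℤ.+ s ℤ.- s
  cancel = ℤ-Solver.solve-∀
  pos-*³ : + (p * q * t) ≡ + p ℤ.* + q ℤ.* + t
  pos-*³ = trans (ℤ.pos-* (p * q) t) (cong (ℤ._* + t) (ℤ.pos-* p q))

lemma5 : (p q t : ℕ) → Prime p → Prime q → Prime t →
         p ≢ q → p ≢ t → q ≢ t →
         (r₁ r₂ r₃ : ℤ) →
         + countγ≤1 p q t r₁ r₂ r₃ ≡ A₃ p q t
lemma5 p q t p-prime q-prime t-prime p≢q p≢t q≢t r₁ r₂ r₃ =
  +≡A₃ p q t (countγ≤1-pairwise-coprime p q t p⊥q p⊥t q⊥t r₁ r₂ r₃)
  where
  instance
    p≢0 : NonZero p
    p≢0 = prime⇒nonZero p-prime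
    q≢0 : NonZero q
    q≢0 = prime⇒nonZero q-prime
    t≢0 : NonZero t
    t≢0 = prime⇒nonZero t-prime
  p⊥q : Coprime p q
  p⊥q = ≢⇒coprime p-prime q-prime p≢q
  p⊥t : Coprime p t
  p⊥t = ≢⇒coprime p-prime t-prime p≢t
  q⊥t : Coprime q t
  q⊥t = ≢⇒coprime q-prime t-prime q≢t
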